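{- Let $p>11$ be a prime with $p\equiv 5\pmod 6$, let $S=\{x\in\{1,2,\dots,\frac{p-5}{6}\}: x\equiv 1\pmod 3\}\subseteq\mathbb{F}_p$, and let $G_p$ be the graph with vertex set $V=S\times\mathbb{F}_p\times\mathbb{F}_p$ in which $x=(x_1,x_2,x_3)$ and $y=(y_1,y_2,y_3)$ are adjacent if and only if $x\ne y$, $x_2+y_3=x_1y_1^{2}$ and $x_3+y_2=x_1^{2}y_1$. Suppose $G_p$ contains a copy of the theta graph $\theta_{3,3}$ on distinct vertices $d,a,b,c,x,y,z,w$ with edge set $\{da,db,dc,ax,by,cz,wx,wy,wz\}$. Then $a_1y_1-a_1z_1-b_1x_1+b_1z_1+c_1x_1-c_1y_1=0$ in $\mathbb{F}_p$.
   Context: Coordinates of a vertex $v\in V$ are written $v=(v_1,v_2,v_3)$. The theta graph $\theta_{3,3}$ consists of three internally disjoint paths of length $3$ between two endpoints (here $d$ and $w$). -}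

module Defs where

open import Data.Nat as ℕ using (ℕ; _<_; _≤_; NonZero)
open import Data.Nat.DivMod using (_mod_; _%_)
open import Data.Nat.Primality using (Prime)
open import Data.Fin using (Fin; toℕ)
open import Data.Product using (_×_; _,_; proj₁; proj₂)
open import Relation.Binary.PropositionalEquality using (_≡_)
open import Relation.Nullary using (¬_)

module Field (p : ℕ) .{{_ : NonZero p}} where
  F : Set
  F = Fin p

  infixl 6 _+F_ _-F_
  infixl 7 _*F_

  _+F_ : F → F → F
  a +F b = (toℕ a ℕ.+ toℕ b) mod p

  _*F_ : F → F → F
  a *F b = (toℕ a ℕ.* toℕ b) mod p

  -F_ : F → F
  -F a = (p ℕ.∸ toℕ a) mod p

  _-F_ : F → F → F
  a -F b = a +F (-F b)

  0F : F
  0F = 0 mod p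

  InS : F → Set
  InS x = 1 ≤ toℕ x × toℕ x ≤ (p ℕ.∸ 5) ℕ./ 6 × toℕ x % 3 ≡ 1

  Vertex : Set
  Vertex = F × F × F

  IsVertex : Vertex → Set
  IsVertex v = InS (proj₁ v)

  c₁ c₂ c₃ : Vertex → F
  c₁ v = proj₁ v
  c₂ v = proj₁ (proj₂ v)
  c₃ v = proj₂ (proj₂ v)

  Adj : Vertex → Vertex → Set
  Adj x y = ¬ (x ≡ y)
          × (c₂ x +F c₃ y ≡ c₁ x *F (c₁ y *F c₁ y))
          × (c₃ x +F c₂ y ≡ (c₁ x *F c₁ x) *F c₁ y)

{-# OPTIONS --safe #-}
-- Let P and Q be the defects of the two adjacency equations between the endpoints d and w.
-- Along each branch d–a–x–w the adjacency equations telescope to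
--   P = (d₁ − x₁)(a₁ − w₁)(a₁ + w₁)  and  Q = (d₁ − x₁)(a₁ − w₁)(d₁ + x₁),
-- and the common factor is nonzero because among the neighbours of a fixed vertex a vertex is
-- determined by its first coordinate. So (a₁ + w₁, d₁ + x₁), (b₁ + w₁, d₁ + y₁), (c₁ + w₁, d₁ + z₁)
-- are all parallel to (P, Q), which makes the points (a₁, x₁), (b₁, y₁), (c₁, z₁) collinear up to
-- the factor P: P · Δ = 0 for the determinant Δ of the claim. Finally P ≠ 0, for otherwise
-- a₁ = −w₁ = b₁ and hence a = b.
module Submission where

open import Defs
open import Data.Nat using (ℕ; _<_; _%_; NonZero)
open import Data.Nat.Primality using (Prime)
open import Data.List using (_∷_; [])
open import Data.List.Relation.Unary.All using (All; []; _∷_)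
open import Data.List.Relation.Unary.Unique.Propositional using (Unique)
open import Data.List.Relation.Unary.AllPairs using ([]; _∷_)
open import Data.Product using (_×_)
open import Relation.Binary.PropositionalEquality using (_≡_)

import Data.Nat as ℕ
import Data.Nat.Properties as ℕ
open import Data.Nat.DivMod using (_mod_; _/_; m≡m%n+[m/n]*n; m%n<n; m<n⇒m%n≡m)
open import Data.Nat.Divisibility using (n∣m⇒m%n≡0) renaming (_∣_ to _ℕ∣_)
open import Data.Nat.Primality using (euclidsLemma)
open import Data.Fin using (toℕ)
open import Data.Fin.Properties using (toℕ-injective; toℕ-fromℕ<; toℕ<n)
open import Data.Integer using (ℤ; +_; _+_; _*_; _-_; -_; ∣_∣)
open import Data.Integer.Properties
  using (+-injective; pos-+; pos-*; ⊖-≥; m-n≡m⊖n; ∣m⊝n∣≤m⊔n; i-j≡0⇒i≡j; ∣i∣≡0⇒i≡0;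
         abs-*; +-identityˡ; +-identityʳ; +-inverseʳ)
open import Data.Integer.Divisibility.Signed
  using (_∣_; divides; ∣-refl; ∣ᵤ⇒∣; ∣⇒∣ᵤ; ∣m∣n⇒∣m+n; ∣m∣n⇒∣m-n; ∣m⇒∣-m; ∣n⇒∣m*n; ∣m⇒∣m*n)
open import Data.Integer.Tactic.RingSolver using (solve-∀)
open import Data.Product using (_,_; proj₁; proj₂)
open import Data.Sum using (_⊎_; [_,_]′)
import Data.Sum as Sum
open import Data.Empty using (⊥-elim)
open import Function using (_∘_; id)
open import Level using (0ℓ)
open import Relation.Binary.Bundles using (Setoid)
open import Relation.Binary.PropositionalEquality using (refl; sym; trans; cong; cong₂; subst)
import Relation.Binary.Reasoning.Setoid as SetoidReasoning
open import Relation.Nullary using (¬_)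

det : ℤ → ℤ → ℤ → ℤ → ℤ → ℤ → ℤ
det u₁ u₂ u₃ v₁ v₂ v₃ = u₁ * v₂ - u₁ * v₃ - u₂ * v₁ + u₂ * v₃ + u₃ * v₁ - u₃ * v₂

det-translate : ∀ s t u₁ u₂ u₃ v₁ v₂ v₃ →
  det (u₁ + s) (u₂ + s) (u₃ + s) (t + v₁) (t + v₂) (t + v₃) ≡ det u₁ u₂ u₃ v₁ v₂ v₃
det-translate = identity
  where
  identity : ∀ s t u₁ u₂ u₃ v₁ v₂ v₃ →
    (u₁ + s) * (t + v₂) - (u₁ + s) * (t + v₃) - (u₂ + s) * (t + v₁)
      + (u₂ + s) * (t + v₃) + (u₃ + s) * (t + v₁) - (u₃ + s) * (t + v₂)
    ≡ u₁ * v₂ - u₁ * v₃ - u₂ * v₁ + u₂ * v₃ + u₃ * v₁ - u₃ * v₂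
  identity = solve-∀

module Congruence (n : ℕ) where

  infix 4 _≈_
  record _≈_ (i j : ℤ) : Set where
    constructor mk≈
    field n∣i-j : + n ∣ i - j

  ≈-via : ∀ {i j k} → k ≡ i - j → + n ∣ k → i ≈ j
  ≈-via k≡i-j n∣k = mk≈ (subst (+ n ∣_) k≡i-j n∣k)

  ≈-refl : ∀ {i} → i ≈ i
  ≈-refl {i} = mk≈ (divides (+ 0) (+-inverseʳ i))

  ≈-reflexive : ∀ {i j} → i ≡ j → i ≈ j
  ≈-reflexive refl = ≈-refl

  ≈-sym : ∀ {i j} → i ≈ j → j ≈ i
  ≈-sym {i} {j} (mk≈ h) = ≈-via (identity i j) (∣m⇒∣-m h)
    where
    identity : ∀ i j → - (i - j) ≡ j - i
    identity = solve-∀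

  ≈-trans : ∀ {i j k} → i ≈ j → j ≈ k → i ≈ k
  ≈-trans {i} {j} {k} (mk≈ h) (mk≈ h′) = ≈-via (identity i j k) (∣m∣n⇒∣m+n h h′)
    where
    identity : ∀ i j k → (i - j) + (j - k) ≡ i - k
    identity = solve-∀

  ≈-setoid : Setoid 0ℓ 0ℓ
  ≈-setoid = record
    { Carrier = ℤ
    ; _≈_ = _≈_
    ; isEquivalence = record { refl = ≈-refl ; sym = ≈-sym ; trans = ≈-trans }
    }

  +-cong : ∀ {i j k l} → i ≈ j → k ≈ l → i + k ≈ j + l
  +-cong {i} {j} {k} {l} (mk≈ h) (mk≈ h′) = ≈-via (identity i j k l) (∣m∣n⇒∣m+n h h′)
    where
    identity : ∀ i j k l → (i - j) + (k - l) ≡ (i + k) - (j + l)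
    identity = solve-∀

  sub-cong : ∀ {i j k l} → i ≈ j → k ≈ l → i - k ≈ j - l
  sub-cong {i} {j} {k} {l} (mk≈ h) (mk≈ h′) = ≈-via (identity i j k l) (∣m∣n⇒∣m-n h h′)
    where
    identity : ∀ i j k l → (i - j) - (k - l) ≡ (i - k) - (j - l)
    identity = solve-∀

  -‿cong : ∀ {i j} → i ≈ j → - i ≈ - j
  -‿cong {i} {j} (mk≈ h) = ≈-via (identity i j) (∣m⇒∣-m h)
    where
    identity : ∀ i j → - (i - j) ≡ - i - - j
    identity = solve-∀

  *-cong : ∀ {i j k l} → i ≈ j → k ≈ l → i * k ≈ j * l
  *-cong {i} {j} {k} {l} (mk≈ h) (mk≈ h′) =
    ≈-via (identity i j k l) (∣m∣n⇒∣m+n (∣m⇒∣m*n k h) (∣n⇒∣m*n j h′))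
    where
    identity : ∀ i j k l → (i - j) * k + j * (k - l) ≡ i * k - j * l
    identity = solve-∀

  +-multiple≈ : ∀ i q → i + q * + n ≈ i
  +-multiple≈ i q = ≈-via (identity i q (+ n)) (∣n⇒∣m*n q ∣-refl)
    where
    identity : ∀ i q N → q * N ≡ (i + q * N) - i
    identity = solve-∀

  +-cancelʳ-≈ : ∀ {i j k} → i + k ≈ j + k → i ≈ j
  +-cancelʳ-≈ {i} {j} {k} (mk≈ h) = ≈-via (identity i j k) h
    where
    identity : ∀ i j k → (i + k) - (j + k) ≡ i - j
    identity = solve-∀

  ∣⇒≈0 : ∀ {i} → + n ∣ i → i ≈ + 0
  ∣⇒≈0 {i} = ≈-via (sym (+-identityʳ i))

  ≈0⇒∣ : ∀ {i} → i ≈ + 0 → + n ∣ i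
  ≈0⇒∣ {i} (mk≈ h) = subst (+ n ∣_) (+-identityʳ i) h

  i≈j⇒i-j≈0 : ∀ {i j} → i ≈ j → i - j ≈ + 0
  i≈j⇒i-j≈0 (mk≈ h) = ∣⇒≈0 h

  i-j≈0⇒i≈j : ∀ {i j} → i - j ≈ + 0 → i ≈ j
  i-j≈0⇒i≈j h = mk≈ (≈0⇒∣ h)

  open SetoidReasoning ≈-setoid

  infix 4 _∥_
  record _∥_ (u v : ℤ × ℤ) : Set where
    constructor mk∥
    field cross : proj₁ u * proj₂ v ≈ proj₂ u * proj₁ v

  det-parallel : ∀ {P Q U₁ U₂ U₃ V₁ V₂ V₃} →
    (U₁ , V₁) ∥ (P , Q) → (U₂ , V₂) ∥ (P , Q) → (U₃ , V₃) ∥ (P , Q) → P * det U₁ U₂ U₃ V₁ V₂ V₃ ≈ + 0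
  det-parallel {P} {Q} {U₁} {U₂} {U₃} {V₁} {V₂} {V₃} (mk∥ h₁) (mk∥ h₂) (mk∥ h₃) = begin
    P * det U₁ U₂ U₃ V₁ V₂ V₃
      ≡⟨ expand P U₁ U₂ U₃ V₁ V₂ V₃ ⟩
    U₁ * (V₂ * P - V₃ * P) + U₂ * (V₃ * P - V₁ * P) + U₃ * (V₁ * P - V₂ * P)
      ≈⟨ +-cong (+-cong (*-cong (≈-refl {U₁}) (sub-cong (≈-sym h₂) (≈-sym h₃)))
                        (*-cong (≈-refl {U₂}) (sub-cong (≈-sym h₃) (≈-sym h₁))))
                (*-cong (≈-refl {U₃}) (sub-cong (≈-sym h₁) (≈-sym h₂))) ⟩
    U₁ * (U₂ * Q - U₃ * Q) + U₂ * (U₃ * Q - U₁ * Q) + U₃ * (U₁ * Q - U₂ * Q)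
      ≡⟨ cancel U₁ U₂ U₃ Q ⟩
    + 0 ∎
    where
    expand : ∀ P U₁ U₂ U₃ V₁ V₂ V₃ →
      P * (U₁ * V₂ - U₁ * V₃ - U₂ * V₁ + U₂ * V₃ + U₃ * V₁ - U₃ * V₂)
        ≡ U₁ * (V₂ * P - V₃ * P) + U₂ * (V₃ * P - V₁ * P) + U₃ * (V₁ * P - V₂ * P)
    expand = solve-∀
    cancel : ∀ U₁ U₂ U₃ Q → U₁ * (U₂ * Q - U₃ * Q) + U₂ * (U₃ * Q - U₁ * Q) + U₃ * (U₁ * Q - U₂ * Q) ≡ + 0
    cancel = solve-∀

module PrimeModulus {p : ℕ} (p-prime : Prime p) where
  open Congruence p
  open SetoidReasoning ≈-setoid

  i*j≈0⇒i≈0⊎j≈0 : ∀ {i j} → i * j ≈ + 0 → i ≈ + 0 ⊎ j ≈ + 0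
  i*j≈0⇒i≈0⊎j≈0 {i} {j} h = Sum.map (∣⇒≈0 ∘ ∣ᵤ⇒∣) (∣⇒≈0 ∘ ∣ᵤ⇒∣)
    (euclidsLemma ∣ i ∣ ∣ j ∣ p-prime (subst (p ℕ∣_) (abs-* i j) (∣⇒∣ᵤ (≈0⇒∣ h))))

  *-cancelˡ-≈0 : ∀ {m i} → ¬ m ≈ + 0 → m * i ≈ + 0 → i ≈ + 0
  *-cancelˡ-≈0 m≉0 = [ ⊥-elim ∘ m≉0 , id ]′ ∘ i*j≈0⇒i≈0⊎j≈0

  ∥-common-factor : ∀ {m P Q U V} → ¬ m ≈ + 0 → P ≈ m * U → Q ≈ m * V → (U , V) ∥ (P , Q)
  ∥-common-factor {m} {P} {Q} {U} {V} m≉0 P≈mU Q≈mV = mk∥ (i-j≈0⇒i≈j (*-cancelˡ-≈0 m≉0 (begin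
    m * (U * Q - V * P)        ≡⟨ expand m U V P Q ⟩
    (m * U) * Q - (m * V) * P  ≈⟨ sub-cong (*-cong (≈-sym P≈mU) ≈-refl) (*-cong (≈-sym Q≈mV) ≈-refl) ⟩
    P * Q - Q * P              ≡⟨ cancel P Q ⟩
    + 0                        ∎)))
    where
    expand : ∀ m U V P Q → m * (U * Q - V * P) ≡ (m * U) * Q - (m * V) * P
    expand = solve-∀
    cancel : ∀ P Q → P * Q - Q * P ≡ + 0
    cancel = solve-∀

module Residues (n : ℕ) .{{_ : NonZero n}} where
  open Field n
  open Congruence n
  open SetoidReasoning ≈-setoid

  -- Opaque so that goals of the form toℤ (a +F b) ≈ … determine a and b by unification.
  opaque
    toℤ : F → ℤ
    toℤ a = + toℕ a

  opaque
    unfolding toℤ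

    toℤ-mod : ∀ m → toℤ (m mod n) ≈ + m
    toℤ-mod m = begin
      toℤ (m mod n)                ≡⟨ cong +_ (toℕ-fromℕ< (m%n<n m n)) ⟩
      + (m % n)                    ≈⟨ +-multiple≈ (+ (m % n)) (+ (m / n)) ⟨
      + (m % n) + + (m / n) * + n  ≡⟨ cong (_+_ (+ (m % n))) (pos-* (m / n) n) ⟨
      + (m % n) + + (m / n ℕ.* n)  ≡⟨ pos-+ (m % n) (m / n ℕ.* n) ⟨
      + (m % n ℕ.+ m / n ℕ.* n)    ≡⟨ cong +_ (m≡m%n+[m/n]*n m n) ⟨
      + m                          ∎

    toℤ-+ : ∀ {a b i j} → toℤ a ≈ i → toℤ b ≈ j → toℤ (a +F b) ≈ i + j
    toℤ-+ {a} {b} a≈i b≈j =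
      ≈-trans (toℤ-mod (toℕ a ℕ.+ toℕ b)) (≈-trans (≈-reflexive (pos-+ (toℕ a) (toℕ b))) (+-cong a≈i b≈j))

    toℤ-* : ∀ {a b i j} → toℤ a ≈ i → toℤ b ≈ j → toℤ (a *F b) ≈ i * j
    toℤ-* {a} {b} a≈i b≈j =
      ≈-trans (toℤ-mod (toℕ a ℕ.* toℕ b)) (≈-trans (≈-reflexive (pos-* (toℕ a) (toℕ b))) (*-cong a≈i b≈j))

    toℤ-neg : ∀ a → toℤ (-F a) ≈ - toℤ a
    toℤ-neg a = begin
      toℤ (-F a)        ≈⟨ toℤ-mod (n ℕ.∸ toℕ a) ⟩
      + (n ℕ.∸ toℕ a)   ≡⟨ sym (trans (m-n≡m⊖n n (toℕ a)) (⊖-≥ (ℕ.<⇒≤ (toℕ<n a)))) ⟩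
      + n - toℤ a       ≈⟨ ≈-via (identity (+ n) (toℤ a)) ∣-refl ⟩
      - toℤ a           ∎
      where
      identity : ∀ N i → N ≡ (N - i) - (- i)
      identity = solve-∀

    toℤ-injective : ∀ {a b} → toℤ a ≈ toℤ b → a ≡ b
    toℤ-injective {a} {b} (mk≈ n∣a-b) =
      toℕ-injective (+-injective (i-j≡0⇒i≡j (toℤ a) (toℤ b) (∣i∣≡0⇒i≡0 distance≡0)))
      where
      distance<n : ∣ toℤ a - toℤ b ∣ < n
      distance<n = subst (_< n) (cong ∣_∣ (sym (m-n≡m⊖n (toℕ a) (toℕ b))))
        (ℕ.≤-<-trans (∣m⊝n∣≤m⊔n (toℕ a) (toℕ b)) (ℕ.⊔-pres-<m (toℕ<n a) (toℕ<n b)))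
      distance≡0 : ∣ toℤ a - toℤ b ∣ ≡ 0
      distance≡0 = trans (sym (m<n⇒m%n≡m distance<n)) (n∣m⇒m%n≡0 _ n (∣⇒∣ᵤ n∣a-b))

  toℤ-0F : toℤ 0F ≈ + 0
  toℤ-0F = toℤ-mod 0

  toℤ-- : ∀ {a b i j} → toℤ a ≈ i → toℤ b ≈ j → toℤ (a -F b) ≈ i - j
  toℤ-- {b = b} a≈i b≈j = toℤ-+ a≈i (≈-trans (toℤ-neg b) (-‿cong b≈j))

  toℤ-det : ∀ a b c x y z →
    toℤ (a *F y -F a *F z -F b *F x +F b *F z +F c *F x -F c *F y)
      ≈ det (toℤ a) (toℤ b) (toℤ c) (toℤ x) (toℤ y) (toℤ z)
  toℤ-det a b c x y z =
    toℤ-- (toℤ-+ (toℤ-+ (toℤ-- (toℤ-- (prod a y) (prod a z)) (prod b x)) (prod b z)) (prod c x)) (prod c y)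
    where
    prod : ∀ s t → toℤ (s *F t) ≈ toℤ s * toℤ t
    prod s t = toℤ-* ≈-refl ≈-refl

  +F-comm : ∀ a b → a +F b ≡ b +F a
  +F-comm a b = cong (_mod n) (ℕ.+-comm (toℕ a) (toℕ b))

  *F-comm : ∀ a b → a *F b ≡ b *F a
  *F-comm a b = cong (_mod n) (ℕ.*-comm (toℕ a) (toℕ b))

  +F-cancelˡ : ∀ {a b c} → a +F b ≡ a +F c → b ≡ c
  +F-cancelˡ {a} {b} {c} eq = toℤ-injective (begin
    toℤ b                    ≡⟨ identity (toℤ a) (toℤ b) ⟩
    toℤ a + toℤ b - toℤ a    ≈⟨ sub-cong (toℤ-+ ≈-refl ≈-refl) ≈-refl ⟨
    toℤ (a +F b) - toℤ a     ≡⟨ cong (λ s → toℤ s - toℤ a) eq ⟩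
    toℤ (a +F c) - toℤ a     ≈⟨ sub-cong (toℤ-+ ≈-refl ≈-refl) ≈-refl ⟩
    toℤ a + toℤ c - toℤ a    ≡⟨ identity (toℤ a) (toℤ c) ⟨
    toℤ c                    ∎)
    where
    identity : ∀ i j → j ≡ i + j - i
    identity = solve-∀

module Gp (p : ℕ) .{{_ : NonZero p}} where
  open Field p
  open Congruence p
  open Residues p
  open SetoidReasoning ≈-setoid

  Adj-sym : ∀ {u v} → Adj u v → Adj v u
  Adj-sym {u} {v} (u≢v , e₂₃ , e₃₂) =
    u≢v ∘ sym ,
    trans (+F-comm (c₂ v) (c₃ u)) (trans e₃₂ (*F-comm (c₁ u *F c₁ u) (c₁ v))) ,
    trans (+F-comm (c₃ v) (c₂ u)) (trans e₂₃ (*F-comm (c₁ u) (c₁ v *F c₁ v)))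

  neighbour-unique : ∀ {u v v′} → Adj u v → Adj u v′ → c₁ v ≡ c₁ v′ → v ≡ v′
  neighbour-unique {v = v₁ , _ , _} (_ , e₂₃ , e₃₂) (_ , e₂₃′ , e₃₂′) refl =
    cong₂ (λ v₂ v₃ → v₁ , v₂ , v₃) (+F-cancelˡ (trans e₃₂ (sym e₃₂′))) (+F-cancelˡ (trans e₂₃ (sym e₂₃′)))

  ⟦_⟧₁ ⟦_⟧₂ ⟦_⟧₃ : Vertex → ℤ
  ⟦ v ⟧₁ = toℤ (c₁ v)
  ⟦ v ⟧₂ = toℤ (c₂ v)
  ⟦ v ⟧₃ = toℤ (c₃ v)

  defect₁ defect₂ : Vertex → Vertex → ℤ
  defect₁ u v = ⟦ u ⟧₂ + ⟦ v ⟧₃ - ⟦ u ⟧₁ * (⟦ v ⟧₁ * ⟦ v ⟧₁)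
  defect₂ u v = ⟦ u ⟧₃ + ⟦ v ⟧₂ - (⟦ u ⟧₁ * ⟦ u ⟧₁) * ⟦ v ⟧₁

  Adj⇒defect₁≈0 : ∀ {u v} → Adj u v → defect₁ u v ≈ + 0
  Adj⇒defect₁≈0 {u} {v} (_ , e₂₃ , _) = i≈j⇒i-j≈0 (begin
    ⟦ u ⟧₂ + ⟦ v ⟧₃                ≈⟨ toℤ-+ ≈-refl ≈-refl ⟨
    toℤ (c₂ u +F c₃ v)             ≡⟨ cong toℤ e₂₃ ⟩
    toℤ (c₁ u *F (c₁ v *F c₁ v))   ≈⟨ toℤ-* ≈-refl (toℤ-* ≈-refl ≈-refl) ⟩
    ⟦ u ⟧₁ * (⟦ v ⟧₁ * ⟦ v ⟧₁)     ∎)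

  Adj⇒defect₂≈0 : ∀ {u v} → Adj u v → defect₂ u v ≈ + 0
  Adj⇒defect₂≈0 {u} {v} (_ , _ , e₃₂) = i≈j⇒i-j≈0 (begin
    ⟦ u ⟧₃ + ⟦ v ⟧₂                ≈⟨ toℤ-+ ≈-refl ≈-refl ⟨
    toℤ (c₃ u +F c₂ v)             ≡⟨ cong toℤ e₃₂ ⟩
    toℤ ((c₁ u *F c₁ u) *F c₁ v)   ≈⟨ toℤ-* (toℤ-* ≈-refl ≈-refl) ≈-refl ⟩
    (⟦ u ⟧₁ * ⟦ u ⟧₁) * ⟦ v ⟧₁     ∎)

  record Path₃ (d a x w : Vertex) : Set where
    constructor path₃
    field
      d~a : Adj d a
      a~x : Adj a x
      w~x : Adj w x
      d≢x : ¬ d ≡ x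
      a≢w : ¬ a ≡ w

  pathFactor : Vertex → Vertex → Vertex → Vertex → ℤ
  pathFactor d a x w = (⟦ d ⟧₁ - ⟦ x ⟧₁) * (⟦ a ⟧₁ - ⟦ w ⟧₁)

  module _ {d a x w : Vertex} (path : Path₃ d a x w) where
    open Path₃ path

    path-defect₁ : defect₁ d w ≈ pathFactor d a x w * (⟦ a ⟧₁ + ⟦ w ⟧₁)
    path-defect₁ = begin
      defect₁ d w
        ≡⟨ split ⟦ d ⟧₁ ⟦ d ⟧₂ ⟦ a ⟧₁ ⟦ a ⟧₃ ⟦ x ⟧₁ ⟦ x ⟧₂ ⟦ w ⟧₁ ⟦ w ⟧₃ ⟩
      defect₁ d a - defect₂ a x + defect₂ w x + pathFactor d a x w * (⟦ a ⟧₁ + ⟦ w ⟧₁)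
        ≈⟨ +-cong (+-cong (sub-cong (Adj⇒defect₁≈0 d~a) (Adj⇒defect₂≈0 a~x)) (Adj⇒defect₂≈0 w~x)) ≈-refl ⟩
      + 0 - + 0 + + 0 + pathFactor d a x w * (⟦ a ⟧₁ + ⟦ w ⟧₁)
        ≡⟨ +-identityˡ _ ⟩
      pathFactor d a x w * (⟦ a ⟧₁ + ⟦ w ⟧₁) ∎
      where
      split : ∀ d₁ d₂ a₁ a₃ x₁ x₂ w₁ w₃ →
        d₂ + w₃ - d₁ * (w₁ * w₁)
          ≡ (d₂ + a₃ - d₁ * (a₁ * a₁)) - (a₃ + x₂ - (a₁ * a₁) * x₁) + (w₃ + x₂ - (w₁ * w₁) * x₁)
            + (d₁ - x₁) * (a₁ - w₁) * (a₁ + w₁)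
      split = solve-∀

    path-defect₂ : defect₂ d w ≈ pathFactor d a x w * (⟦ d ⟧₁ + ⟦ x ⟧₁)
    path-defect₂ = begin
      defect₂ d w
        ≡⟨ split ⟦ d ⟧₁ ⟦ d ⟧₃ ⟦ a ⟧₁ ⟦ a ⟧₂ ⟦ x ⟧₁ ⟦ x ⟧₃ ⟦ w ⟧₁ ⟦ w ⟧₂ ⟩
      defect₂ d a - defect₁ a x + defect₁ w x + pathFactor d a x w * (⟦ d ⟧₁ + ⟦ x ⟧₁)
        ≈⟨ +-cong (+-cong (sub-cong (Adj⇒defect₂≈0 d~a) (Adj⇒defect₁≈0 a~x)) (Adj⇒defect₁≈0 w~x)) ≈-refl ⟩
      + 0 - + 0 + + 0 + pathFactor d a x w * (⟦ d ⟧₁ + ⟦ x ⟧₁)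
        ≡⟨ +-identityˡ _ ⟩
      pathFactor d a x w * (⟦ d ⟧₁ + ⟦ x ⟧₁) ∎
      where
      split : ∀ d₁ d₃ a₁ a₂ x₁ x₃ w₁ w₂ →
        d₃ + w₂ - (d₁ * d₁) * w₁
          ≡ (d₃ + a₂ - (d₁ * d₁) * a₁) - (a₂ + x₃ - a₁ * (x₁ * x₁)) + (w₂ + x₃ - w₁ * (x₁ * x₁))
            + (d₁ - x₁) * (a₁ - w₁) * (d₁ + x₁)
      split = solve-∀

  module _ (p-prime : Prime p) where
    open PrimeModulus p-prime

    module _ {d a x w : Vertex} (path : Path₃ d a x w) where
      open Path₃ path

      pathFactor≉0 : ¬ pathFactor d a x w ≈ + 0
      pathFactor≉0 = [ d≢x ∘ d≡x , a≢w ∘ a≡w ]′ ∘ i*j≈0⇒i≈0⊎j≈0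
        where
        d≡x : ⟦ d ⟧₁ - ⟦ x ⟧₁ ≈ + 0 → d ≡ x
        d≡x = neighbour-unique (Adj-sym d~a) a~x ∘ toℤ-injective ∘ i-j≈0⇒i≈j
        a≡w : ⟦ a ⟧₁ - ⟦ w ⟧₁ ≈ + 0 → a ≡ w
        a≡w = neighbour-unique (Adj-sym a~x) (Adj-sym w~x) ∘ toℤ-injective ∘ i-j≈0⇒i≈j

      path-∥-defects : (⟦ a ⟧₁ + ⟦ w ⟧₁ , ⟦ d ⟧₁ + ⟦ x ⟧₁) ∥ (defect₁ d w , defect₂ d w)
      path-∥-defects = ∥-common-factor pathFactor≉0 (path-defect₁ path) (path-defect₂ path)

      defect₁≈0⇒a+w≈0 : defect₁ d w ≈ + 0 → ⟦ a ⟧₁ + ⟦ w ⟧₁ ≈ + 0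
      defect₁≈0⇒a+w≈0 h = *-cancelˡ-≈0 pathFactor≉0 (≈-trans (≈-sym (path-defect₁ path)) h)

    theta-collinear : ∀ {d a b c x y z w} →
      Path₃ d a x w → Path₃ d b y w → Path₃ d c z w → ¬ a ≡ b →
      det ⟦ a ⟧₁ ⟦ b ⟧₁ ⟦ c ⟧₁ ⟦ x ⟧₁ ⟦ y ⟧₁ ⟦ z ⟧₁ ≈ + 0
    theta-collinear {d} {a} {b} {c} {x} {y} {z} {w} pa pb pc a≢b =
      [ ⊥-elim ∘ defect₁≉0 , id ]′ (i*j≈0⇒i≈0⊎j≈0 (begin
        defect₁ d w * det ⟦ a ⟧₁ ⟦ b ⟧₁ ⟦ c ⟧₁ ⟦ x ⟧₁ ⟦ y ⟧₁ ⟦ z ⟧₁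
          ≡⟨ cong (defect₁ d w *_) (det-translate ⟦ w ⟧₁ ⟦ d ⟧₁ ⟦ a ⟧₁ ⟦ b ⟧₁ ⟦ c ⟧₁ ⟦ x ⟧₁ ⟦ y ⟧₁ ⟦ z ⟧₁) ⟨
        defect₁ d w * det (⟦ a ⟧₁ + ⟦ w ⟧₁) (⟦ b ⟧₁ + ⟦ w ⟧₁) (⟦ c ⟧₁ + ⟦ w ⟧₁)
                          (⟦ d ⟧₁ + ⟦ x ⟧₁) (⟦ d ⟧₁ + ⟦ y ⟧₁) (⟦ d ⟧₁ + ⟦ z ⟧₁)
          ≈⟨ det-parallel (path-∥-defects pa) (path-∥-defects pb) (path-∥-defects pc) ⟩
        + 0 ∎))
      where
      defect₁≉0 : ¬ defect₁ d w ≈ + 0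
      defect₁≉0 h = a≢b (neighbour-unique (Path₃.d~a pa) (Path₃.d~a pb) (toℤ-injective
        (+-cancelʳ-≈ (≈-trans (defect₁≈0⇒a+w≈0 pa h) (≈-sym (defect₁≈0⇒a+w≈0 pb h))))))

lemma3p4 : (p : ℕ) → .{{_ : NonZero p}} → Prime p → 11 < p → p % 6 ≡ 5 →
    let open Field p in
    (d a b c x y z w : Vertex) →
    All IsVertex (d ∷ a ∷ b ∷ c ∷ x ∷ y ∷ z ∷ w ∷ []) →
    Unique (d ∷ a ∷ b ∷ c ∷ x ∷ y ∷ z ∷ w ∷ []) →
    Adj d a → Adj d b → Adj d c → Adj a x → Adj b y → Adj c z →
    Adj w x → Adj w y → Adj w z →
    c₁ a *F c₁ y -F c₁ a *F c₁ z -F c₁ b *F c₁ x +F c₁ b *F c₁ z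
      +F c₁ c *F c₁ x -F c₁ c *F c₁ y ≡ 0F
lemma3p4 p p-prime _ _ d a b c x y z w _
  ((_ ∷ _ ∷ _ ∷ d≢x ∷ d≢y ∷ d≢z ∷ _) ∷ (a≢b ∷ _ ∷ _ ∷ _ ∷ _ ∷ a≢w ∷ []) ∷
   (_ ∷ _ ∷ _ ∷ _ ∷ b≢w ∷ []) ∷ (_ ∷ _ ∷ _ ∷ c≢w ∷ []) ∷ _)
  d~a d~b d~c a~x b~y c~z w~x w~y w~z =
  toℤ-injective
    (≈-trans (toℤ-det (c₁ a) (c₁ b) (c₁ c) (c₁ x) (c₁ y) (c₁ z)) (≈-trans collinear (≈-sym toℤ-0F)))
  where
  open Field p
  open Congruence p
  open Residues p
  open Gp p
  collinear : det ⟦ a ⟧₁ ⟦ b ⟧₁ ⟦ c ⟧₁ ⟦ x ⟧₁ ⟦ y ⟧₁ ⟦ z ⟧₁ ≈ + 0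
  collinear = theta-collinear p-prime
    (path₃ d~a a~x w~x d≢x a≢w) (path₃ d~b b~y w~y d≢y b≢w) (path₃ d~c c~z w~z d≢z c≢w) a≢b
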